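{- Let $B_q$ be a biaffine plane of order $q$ and $S=\mathcal{P}_S\cup\mathcal{L}_S$ a set of vertices of its incidence graph ($\mathcal{P}_S$ points, $\mathcal{L}_S$ lines). Then $S$ is a resolving set for $B_q$ if and only if the following hold. (B1) For each blocked class $C$, there is at most one uncovered outer point in $C$; furthermore, there is at most one outer uncovered point in the union of the unblocked classes. (B2) On each inner line, there is at most one $1$-covered point lying in an unblocked class. (B1') For each covered direction $d$, there is at most one skew outer line with direction $d$; furthermore, there is at most one outer skew line having an uncovered direction. (B2') Through each inner point, there is at most one tangent line with uncovered direction.
   Context: A biaffine plane of order $q$ is obtained from an affine plane of order $q$ by deleting all lines of one parallel class (keeping all $q^2$ points). Its directions are the $q$ remaining parallel classes of lines; the direction of a line is its parallel class. Its non-adjacency classes are the $q$ point sets of the deleted lines (each consisting of $q$ pairwise non-collinear points). A resolving set is a vertex set $S$ of the incidence graph (bipartite graph on points and lines, adjacency = incidence) such that every two distinct vertices $u\neq v$ have some $x\in S$ with $d(u,x)\neq d(v,x)$. Elements of $S$ are inner, others outer. A point is $t$-covered if it lies on exactly $t$ lines of $\mathcal{L}_S$, uncovered if $0$-covered. A line is skew (tangent) if it contains no (exactly one) point of $\mathcal{P}_S$. A direction is covered if $\mathcal{L}_S$ contains a line with that direction, uncovered otherwise. A non-adjacency class is blocked if it contains at least one point of $\mathcal{P}_S$, unblocked otherwise. -}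

module Defs where

open import Data.Nat using (ℕ; zero; suc; _<_)
open import Data.Fin using (Fin)
open import Data.Bool using (Bool; true; false)
open import Data.Product using (Σ; _×_; _,_; ∃; proj₁)
open import Data.Sum using (_⊎_)
open import Relation.Nullary using (¬_)
open import Relation.Binary.PropositionalEquality using (_≡_)
open import Function.Bundles using (_↔_)

-- Finite affine planes of order q (Playfair axiomatisation).
-- Incidence is Bool-valued (so it is decidable and proof-irrelevant).

record AffinePlane (q : ℕ) : Set₁ where
  field
    Point : Set
    Line  : Set
    inc   : Point → Line → Bool
    nPoints : ℕ
    nLines  : ℕ
    enumPoints : Fin nPoints ↔ Point
    enumLines  : Fin nLines ↔ Line

  _I_ : Point → Line → Set
  P I l = inc P l ≡ true

  Disjoint : Line → Line → Set
  Disjoint l m = ∀ P → P I l → ¬ (P I m)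

  Parallel : Line → Line → Set
  Parallel l m = (l ≡ m) ⊎ Disjoint l m

  field
    join : ∀ P Q → ¬ (P ≡ Q) →
           Σ Line λ l → P I l × Q I l × (∀ m → P I m → Q I m → m ≡ l)
    playfair : ∀ P l → ¬ (P I l) →
           Σ Line λ m → P I m × Disjoint m l ×
                        (∀ m′ → P I m′ → Disjoint m′ l → m′ ≡ m)
    nondeg : Σ Point λ P → Σ Point λ Q → Σ Point λ R →
             ¬ (P ≡ Q) × ¬ (P ≡ R) × ¬ (Q ≡ R) ×
             (∀ l → P I l → Q I l → ¬ (R I l))
    order : ∀ l → Fin q ↔ Σ Point (λ P → P I l)

-- The biaffine plane obtained from A by deleting the parallel class
-- of the line l₀, its incidence graph, and the notions of the paper.

module Biaffine {q : ℕ} (A : AffinePlane q) (l₀ : AffinePlane.Line A) where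
  open AffinePlane A public

  Deleted : Line → Set
  Deleted l = Parallel l l₀

  record BLine : Set where
    constructor bline
    field
      line : Line
      .kept : ¬ Deleted line
  open BLine public

  Vertex : Set
  Vertex = Point ⊎ BLine

  data Adj : Vertex → Vertex → Set where
    pl : ∀ {P l} → P I line l → Adj (Data.Sum.inj₁ P) (Data.Sum.inj₂ l)
    lp : ∀ {P l} → P I line l → Adj (Data.Sum.inj₂ l) (Data.Sum.inj₁ P)

  data Walk : Vertex → Vertex → ℕ → Set where
    nil  : ∀ {u} → Walk u u zero
    cons : ∀ {u w v n} → Adj u w → Walk w v n → Walk u v (suc n)

  Dist : Vertex → Vertex → ℕ → Set
  Dist u v n = Walk u v n × (∀ m → m < n → ¬ Walk u v m)

  -- x distinguishes u and v: d(u,x) ≠ d(v,x) (with d = ∞ if no walk)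
  Distinguishes : Vertex → Vertex → Vertex → Set
  Distinguishes x u v =
    Σ ℕ λ n → (Dist u x n × ¬ Dist v x n) ⊎ (Dist v x n × ¬ Dist u x n)

  module WithS (inP : Point → Bool) (inL : BLine → Bool) where

    InS : Vertex → Set
    InS (Data.Sum.inj₁ P) = inP P ≡ true
    InS (Data.Sum.inj₂ l) = inL l ≡ true

    Resolving : Set
    Resolving = ∀ u v → ¬ (u ≡ v) → Σ Vertex λ x → InS x × Distinguishes x u v

    InnerP OuterP : Point → Set
    InnerP P = inP P ≡ true
    OuterP P = inP P ≡ false

    InnerL OuterL : BLine → Set
    InnerL l = inL l ≡ true
    OuterL l = inL l ≡ false

    Uncovered : Point → Set
    Uncovered P = ∀ l → InnerL l → ¬ (P I line l)

    OneCovered : Point → Set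
    OneCovered P = Σ BLine λ l → InnerL l × P I line l ×
                   (∀ l′ → InnerL l′ → P I line l′ → l′ ≡ l)

    Skew : BLine → Set
    Skew l = ∀ P → InnerP P → ¬ (P I line l)

    Tangent : BLine → Set
    Tangent l = Σ Point λ P → InnerP P × P I line l ×
                (∀ P′ → InnerP P′ → P′ I line l → P′ ≡ P)

    SameDirection : BLine → BLine → Set
    SameDirection l m = Parallel (line l) (line m)

    DirCovered : BLine → Set
    DirCovered l = Σ BLine λ m → InnerL m × SameDirection m l

    DirUncovered : BLine → Set
    DirUncovered l = ∀ m → InnerL m → ¬ SameDirection m l

    -- non-adjacency classes: point sets of the deleted lines
    SameClass : Point → Point → Set
    SameClass P Q = Σ Line λ m → Deleted m × P I m × Q I m

    Blocked : Point → Set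
    Blocked P = Σ Point λ R → InnerP R × SameClass P R

    Unblocked : Point → Set
    Unblocked P = ∀ R → InnerP R → ¬ SameClass P R

    B1 : Set
    B1 = (∀ P Q → Blocked P → SameClass P Q →
            OuterP P → Uncovered P → OuterP Q → Uncovered Q → P ≡ Q)
       × (∀ P Q → Unblocked P → Unblocked Q →
            OuterP P → Uncovered P → OuterP Q → Uncovered Q → P ≡ Q)

    B2 : Set
    B2 = ∀ l → InnerL l → ∀ P Q → P I line l → Q I line l →
         OneCovered P → Unblocked P → OneCovered Q → Unblocked Q → P ≡ Q

    B1′ : Set
    B1′ = (∀ l m → DirCovered l → SameDirection l m →
             OuterL l → Skew l → OuterL m → Skew m → l ≡ m)
        × (∀ l m → DirUncovered l → DirUncovered m →
             OuterL l → Skew l → OuterL m → Skew m → l ≡ m)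

    B2′ : Set
    B2′ = ∀ P → InnerP P → ∀ l m → P I line l → P I line m →
          Tangent l → DirUncovered l → Tangent m → DirUncovered m → l ≡ m

-- In the incidence graph of a biaffine plane every distance is determined by
-- the geometry: a point and a line are at distance 1 or 3 according to
-- incidence, two points at distance 2 or 4 according to whether they lie in
-- different or the same non-adjacency class, and two lines at distance 2 or 4
-- according to whether they have different or the same direction.  Inner
-- vertices resolve themselves and a point and a line are always separated by
-- parity, so S is resolving iff no two distinct outer points agree on their
-- incidences with inner lines and their classes relative to inner points,
-- and dually for outer lines.  Conditions (B1), (B2) describe exactly the
-- possible pairs of distinct agreeing outer points (both uncovered, or both
-- 1-covered on the same inner line), and (B1'), (B2') the dual pairs of lines.
module Submission where

open import Defs
open import Data.Nat using (ℕ; zero; suc; _<_; s≤s)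
open import Data.Nat.Properties using (<-cmp)
open import Data.Bool using (Bool; true)
open import Data.Bool.Properties using (¬-not) renaming (_≟_ to _≟ᴮ_)
open import Data.Fin using (Fin)
open import Data.Fin.Properties using (inj⇒≟; any?)
open import Data.Product using (Σ; _×_; _,_; proj₁; proj₂; ∃)
open import Data.Product.Properties using (Σ-≡,≡→≡)
open import Data.Sum using (_⊎_; inj₁; inj₂)
open import Data.Sum.Properties as Sum using (inj₁-injective; inj₂-injective)
open import Data.Empty using (⊥; ⊥-elim-irr)
open import Relation.Nullary using (¬_; Dec; yes; no; contradiction)
open import Relation.Nullary.Decidable using (_×-dec_; _⊎-dec_; ¬?; map′; decidable-stable)
open import Relation.Unary using (Decidable)
open import Relation.Binary.Definitions using (DecidableEquality; tri<; tri≈; tri>)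
open import Relation.Binary.PropositionalEquality
open import Axiom.UniquenessOfIdentityProofs using (module Decidable⇒UIP)
open import Function.Bundles using (_⇔_; _↔_; mk⇔; Inverse; Injection; Equivalence)
open import Function.Properties.Inverse using (↔-sym; ↔⇒↣)

Differ : Set → Set → Set
Differ A B = (A × ¬ B) ⊎ (¬ A × B)

differ? : {A B : Set} → Dec A → Dec B → Dec (Differ A B)
differ? a? b? = (a? ×-dec ¬? b?) ⊎-dec (¬? a? ×-dec b?)

¬differ⇒⇔ : {A B : Set} → Dec A → Dec B → ¬ Differ A B → A ⇔ B
¬differ⇒⇔ a? b? ¬d =
  mk⇔ (λ a → decidable-stable b? (λ ¬b → ¬d (inj₁ (a , ¬b))))
      (λ b → decidable-stable a? (λ ¬a → ¬d (inj₂ (¬a , b))))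

¬⇒⇔ : {A B : Set} → ¬ A → ¬ B → A ⇔ B
¬⇒⇔ ¬a ¬b = mk⇔ (λ a → contradiction a ¬a) (λ b → contradiction b ¬b)

Searchable : Set → Set₁
Searchable X = ∀ {Q : X → Set} → Decidable Q → Dec (∃ Q)

∃? : ∀ {n} {X : Set} → Fin n ↔ X → Searchable X
∃? enum {Q} Q? = map′ (λ (i , x) → to i , x) witness (any? (λ i → Q? (to i)))
  where
    open Inverse enum
    witness : ∃ Q → ∃ λ i → Q (to i)
    witness (x , qx) = from x , subst Q (sym (inverseˡ refl)) qx

differing-or-⇔ : {X : Set} → Searchable X → {S A B : X → Set} → Decidable S → Decidable A → Decidable B →
                 (∃ λ x → S x × Differ (A x) (B x)) ⊎ (∀ x → S x → A x ⇔ B x)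
differing-or-⇔ ∃? S? A? B? with ∃? (λ x → S? x ×-dec differ? (A? x) (B? x))
... | yes differing = inj₁ differing
... | no ¬differing = inj₂ λ x sx → ¬differ⇒⇔ (A? x) (B? x) (λ d → ¬differing (x , sx , d))

module Geometry {q : ℕ} (A : AffinePlane q) (l₀ : AffinePlane.Line A) where
  open Biaffine A l₀

  _≟ᴾ_ : DecidableEquality Point
  _≟ᴾ_ = inj⇒≟ (↔⇒↣ (↔-sym enumPoints))

  _≟ᴸ_ : DecidableEquality Line
  _≟ᴸ_ = inj⇒≟ (↔⇒↣ (↔-sym enumLines))

  incident? : ∀ P l → Dec (P I l)
  incident? P l = inc P l ≟ᴮ true

  incidence-irrelevant : ∀ {P l} (a b : P I l) → a ≡ b
  incidence-irrelevant = Decidable⇒UIP.≡-irrelevant _≟ᴮ_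

  ∃-point? : Searchable Point
  ∃-point? = ∃? enumPoints

  join-unique : ∀ {P Q l m} → P ≢ Q → P I l → Q I l → P I m → Q I m → l ≡ m
  join-unique {P} {Q} {l} {m} P≢Q Pl Ql Pm Qm =
    let (_ , _ , _ , unique) = join P Q P≢Q in trans (unique l Pl Ql) (sym (unique m Pm Qm))

  disjoint? : ∀ l m → Dec (Disjoint l m)
  disjoint? l m =
    map′ (λ ¬common P Pl Pm → ¬common (P , Pl , Pm)) (λ d (P , Pl , Pm) → d P Pl Pm)
         (¬? (∃-point? (λ P → incident? P l ×-dec incident? P m)))

  parallel? : ∀ l m → Dec (Parallel l m)
  parallel? l m = (l ≟ᴸ m) ⊎-dec disjoint? l m

  parallel-refl : ∀ {l} → Parallel l l
  parallel-refl = inj₁ refl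

  parallel-sym : ∀ {l m} → Parallel l m → Parallel m l
  parallel-sym (inj₁ l≡m) = inj₁ (sym l≡m)
  parallel-sym (inj₂ d) = inj₂ (λ P Pm Pl → d P Pl Pm)

  -- Two lines disjoint from m and meeting at P are both the Playfair parallel to m through P.
  parallel-trans : ∀ {l m n} → Parallel l m → Parallel m n → Parallel l n
  parallel-trans (inj₁ refl) p = p
  parallel-trans p (inj₁ refl) = p
  parallel-trans {l} {m} {n} (inj₂ dlm) (inj₂ dmn) with l ≟ᴸ n
  ... | yes l≡n = inj₁ l≡n
  ... | no l≢n = inj₂ λ P Pl Pn →
    let (_ , _ , _ , unique) = playfair P m (dlm P Pl)
    in l≢n (trans (unique l Pl dlm) (sym (unique n Pn (λ R Rn Rm → dmn R Rm Rn))))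

  deleted? : ∀ l → Dec (Deleted l)
  deleted? l = parallel? l l₀

  ¬deleted : (b : BLine) → ¬ Deleted (line b)
  ¬deleted (bline _ kept) d = ⊥-elim-irr (kept d)

  bline-injective : ∀ {b c} → line b ≡ line c → b ≡ c
  bline-injective {bline _ _} {bline _ _} refl = refl

  _≟ᴮᴸ_ : DecidableEquality BLine
  b ≟ᴮᴸ c = map′ bline-injective (cong line) (line b ≟ᴸ line c)

  ∃-bline? : Searchable BLine
  ∃-bline? {Q} Q? =
    map′ (λ (l , kept , x) → bline l kept , x) (λ (b , x) → line b , ¬deleted b , x)
         (∃? enumLines kept-with-Q?)
    where
      kept-with-Q? : ∀ l → Dec (Σ (¬ Deleted l) λ kept → Q (bline l kept))
      kept-with-Q? l with deleted? l
      ... | yes d = no (λ (kept , _) → kept d)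
      ... | no kept = map′ (kept ,_) proj₂ (Q? (bline l kept))

  deleted-line-through : ∀ P → Σ Line λ m → P I m × Deleted m × (∀ m′ → Deleted m′ → P I m′ → m′ ≡ m)
  deleted-line-through P with incident? P l₀
  ... | yes Pl₀ = l₀ , Pl₀ , inj₁ refl , unique
    where
      unique : ∀ m′ → Deleted m′ → P I m′ → m′ ≡ l₀
      unique m′ (inj₁ m′≡l₀) _ = m′≡l₀
      unique m′ (inj₂ d) Pm′ = contradiction Pl₀ (d P Pm′)
  ... | no ¬Pl₀ =
    let (m , Pm , dm , unique) = playfair P l₀ ¬Pl₀
        unique′ : ∀ m′ → Deleted m′ → P I m′ → m′ ≡ m
        unique′ = λ { m′ (inj₁ refl) Pm′ → contradiction Pm′ ¬Pl₀
                    ; m′ (inj₂ d) Pm′ → unique m′ Pm′ d }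
    in m , Pm , inj₂ dm , unique′

  classLine : Point → Line
  classLine P = proj₁ (deleted-line-through P)

  ∈-classLine : ∀ P → P I classLine P
  ∈-classLine P = proj₁ (proj₂ (deleted-line-through P))

  classLine-deleted : ∀ P → Deleted (classLine P)
  classLine-deleted P = proj₁ (proj₂ (proj₂ (deleted-line-through P)))

  classLine-unique : ∀ P {m} → Deleted m → P I m → m ≡ classLine P
  classLine-unique P = proj₂ (proj₂ (proj₂ (deleted-line-through P))) _

  same-class-no-common-bline : ∀ {P Q} (n : BLine) → P ≢ Q → Q I classLine P → P I line n → Q I line n → ⊥
  same-class-no-common-bline {P} n P≢Q Q∈ Pn Qn =
    ¬deleted n (subst Deleted (join-unique P≢Q (∈-classLine P) Q∈ Pn Qn) (classLine-deleted P))

  bline-through : ∀ P R → ¬ R I classLine P → Σ BLine λ n → P I line n × R I line n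
  bline-through P R R∉ with join P R (λ { refl → R∉ (∈-classLine P) })
  ... | l , Pl , Rl , _ with deleted? l
  ... | yes dl = contradiction (subst (R I_) (classLine-unique P dl Pl) Rl) R∉
  ... | no kept = bline l kept , Pl , Rl

  two-indices : Σ (Fin q) λ i → Σ (Fin q) λ j → i ≢ j
  two-indices =
    let (P , Q , _ , P≢Q , _) = nondeg
        (l , Pl , Ql , _) = join P Q P≢Q
        open Inverse (order l) using (from)
        open Injection (↔⇒↣ (↔-sym (order l))) using (injective)
    in from (P , Pl) , from (Q , Ql) , λ i≡j → P≢Q (cong proj₁ (injective i≡j))

  two-points-on : ∀ l → Σ Point λ P → Σ Point λ Q → P ≢ Q × P I l × Q I l
  two-points-on l =
    let (i , j , i≢j) = two-indices
        open Inverse (order l)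
        open Injection (↔⇒↣ (order l)) using (injective)
    in proj₁ (to i) , proj₁ (to j) ,
       (λ P≡Q → i≢j (injective (Σ-≡,≡→≡ (P≡Q , incidence-irrelevant _ _)))) ,
       proj₂ (to i) , proj₂ (to j)

  -- At most one point of b lies in the class of P, since b is not a deleted line.
  bline-meeting : ∀ P (b : BLine) → Σ BLine λ n → Σ Point λ R → P I line n × R I line n × R I line b
  bline-meeting P b with two-points-on (line b)
  ... | X , Y , X≢Y , Xb , Yb with incident? X (classLine P) | incident? Y (classLine P)
  ... | no X∉ | _ = let (n , Pn , Xn) = bline-through P X X∉ in n , X , Pn , Xn , Xb
  ... | yes _ | no Y∉ = let (n , Pn , Yn) = bline-through P Y Y∉ in n , Y , Pn , Yn , Yb
  ... | yes X∈ | yes Y∈ =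
    contradiction (subst Deleted (join-unique X≢Y X∈ Y∈ Xb Yb) (classLine-deleted P)) (¬deleted b)

  point-off-classLine : ∀ P → Σ Point λ T → ¬ T I classLine P
  point-off-classLine P with nondeg
  ... | X , Y , Z , _ , _ , _ , noncollinear with incident? X (classLine P) | incident? Y (classLine P)
  ... | no X∉ | _ = X , X∉
  ... | yes _ | no Y∉ = Y , Y∉
  ... | yes X∈ | yes Y∈ = Z , noncollinear (classLine P) X∈ Y∈

  Adj-sym : ∀ {u v} → Adj u v → Adj v u
  Adj-sym (pl a) = lp a
  Adj-sym (lp a) = pl a

  Walk-snoc : ∀ {u w v n} → Walk u w n → Adj w v → Walk u v (suc n)
  Walk-snoc nil e = cons e nil
  Walk-snoc (cons e′ w) e = cons e′ (Walk-snoc w e)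

  Walk-reverse : ∀ {u v n} → Walk u v n → Walk v u n
  Walk-reverse nil = nil
  Walk-reverse (cons e w) = Walk-snoc (Walk-reverse w) (Adj-sym e)

  Walk-zero : ∀ {u v} → Walk u v 0 → u ≡ v
  Walk-zero nil = refl

  ¬point-and-line-walks : ∀ {P l x n} → Walk (inj₁ P) x n → Walk (inj₂ l) x n → ⊥
  ¬point-and-line-walks (cons (pl _) w) (cons (lp _) w′) = ¬point-and-line-walks w′ w

  Dist-refl : ∀ {u} → Dist u u 0
  Dist-refl = nil , λ _ ()

  Dist-sym : ∀ {u v n} → Dist u v n → Dist v u n
  Dist-sym (w , shortest) = Walk-reverse w , λ m m<n w′ → shortest m m<n (Walk-reverse w′)

  Dist-functional : ∀ {u v m n} → Dist u v m → Dist u v n → m ≡ n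
  Dist-functional {m = m} {n} (w , shortest) (w′ , shortest′) with <-cmp m n
  ... | tri< m<n _ _ = contradiction w (shortest′ m m<n)
  ... | tri≈ _ m≡n _ = m≡n
  ... | tri> _ _ n<m = contradiction w′ (shortest n n<m)

  dist-incident : ∀ {P} {n : BLine} → P I line n → Dist (inj₁ P) (inj₂ n) 1
  dist-incident {n = n} Pn = cons (pl {l = n} Pn) nil , λ { zero _ () ; (suc _) (s≤s ()) _ }

  dist-nonincident : ∀ {P} {n : BLine} → ¬ P I line n → Dist (inj₁ P) (inj₂ n) 3
  dist-nonincident {P} {n} P∉n with bline-meeting P n
  ... | m , R , Pm , Rm , Rn = cons (pl {l = m} Pm) (cons (lp {l = m} Rm) (cons (pl {l = n} Rn) nil)) , shorter
    where
      shorter : ∀ k → k < 3 → ¬ Walk (inj₁ P) (inj₂ n) k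
      shorter 0 _ ()
      shorter 1 _ (cons (pl Pn) nil) = P∉n Pn
      shorter 2 _ (cons (pl _) (cons (lp _) ()))
      shorter (suc (suc (suc _))) (s≤s (s≤s (s≤s ()))) _

  dist-other-class : ∀ {P R} → ¬ R I classLine P → Dist (inj₁ P) (inj₁ R) 2
  dist-other-class {P} {R} R∉ with bline-through P R R∉
  ... | n , Pn , Rn = cons (pl {l = n} Pn) (cons (lp {l = n} Rn) nil) , shorter
    where
      shorter : ∀ k → k < 2 → ¬ Walk (inj₁ P) (inj₁ R) k
      shorter 0 _ nil = R∉ (∈-classLine P)
      shorter 1 _ (cons (pl _) ())
      shorter (suc (suc _)) (s≤s (s≤s ())) _

  -- A shortest walk goes through a point T outside the common class.
  dist-same-class : ∀ {P R} → P ≢ R → R I classLine P → Dist (inj₁ P) (inj₁ R) 4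
  dist-same-class {P} {R} P≢R R∈ with point-off-classLine P
  ... | T , T∉ with bline-through P T T∉
                 | bline-through R T (λ T∈ → T∉ (subst (T I_) classLine-R≡classLine-P T∈))
    where
      classLine-R≡classLine-P : classLine R ≡ classLine P
      classLine-R≡classLine-P = sym (classLine-unique R (classLine-deleted P) R∈)
  ... | n , Pn , Tn | m , Rm , Tm =
    cons (pl {l = n} Pn) (cons (lp {l = n} Tn) (cons (pl {l = m} Tm) (cons (lp {l = m} Rm) nil))) , shorter
    where
      shorter : ∀ k → k < 4 → ¬ Walk (inj₁ P) (inj₁ R) k
      shorter 0 _ nil = P≢R refl
      shorter 1 _ (cons (pl _) ())
      shorter 2 _ (cons (pl {l = k} Pk) (cons (lp Rk) nil)) = same-class-no-common-bline k P≢R R∈ Pk Rk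
      shorter 3 _ (cons (pl _) (cons (lp _) (cons (pl _) ())))
      shorter (suc (suc (suc (suc _)))) (s≤s (s≤s (s≤s (s≤s ())))) _

  dist-nonparallel : ∀ {l n : BLine} → ¬ Parallel (line l) (line n) → Dist (inj₂ l) (inj₂ n) 2
  dist-nonparallel {l} {n} ¬par with ∃-point? (λ P → incident? P (line l) ×-dec incident? P (line n))
  ... | no ¬common = contradiction (inj₂ λ P Pl Pn → ¬common (P , Pl , Pn)) ¬par
  ... | yes (P , Pl , Pn) = cons (lp {l = l} Pl) (cons (pl {l = n} Pn) nil) , shorter
    where
      shorter : ∀ k → k < 2 → ¬ Walk (inj₂ l) (inj₂ n) k
      shorter 0 _ nil = ¬par parallel-refl
      shorter 1 _ (cons (lp _) ())
      shorter (suc (suc _)) (s≤s (s≤s ())) _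

  distinct-parallel⇒disjoint : ∀ {l n : BLine} → l ≢ n → Parallel (line l) (line n) → Disjoint (line l) (line n)
  distinct-parallel⇒disjoint l≢n (inj₁ l≡n) = contradiction (bline-injective l≡n) l≢n
  distinct-parallel⇒disjoint l≢n (inj₂ disjoint) = disjoint

  dist-parallel : ∀ {l n : BLine} → l ≢ n → Parallel (line l) (line n) → Dist (inj₂ l) (inj₂ n) 4
  dist-parallel {l} {n} l≢n par with two-points-on (line l)
  ... | X , _ , _ , Xl , _ with bline-meeting X n
  ... | m , R , Xm , Rm , Rn =
    cons (lp {l = l} Xl) (cons (pl {l = m} Xm) (cons (lp {l = m} Rm) (cons (pl {l = n} Rn) nil))) , shorter
    where
      shorter : ∀ k → k < 4 → ¬ Walk (inj₂ l) (inj₂ n) k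
      shorter 0 _ nil = l≢n refl
      shorter 1 _ (cons (lp _) ())
      shorter 2 _ (cons (lp {P = P} Pl) (cons (pl Pn) nil)) = distinct-parallel⇒disjoint l≢n par P Pl Pn
      shorter 3 _ (cons (lp _) (cons (pl _) (cons (lp _) ())))
      shorter (suc (suc (suc (suc _)))) (s≤s (s≤s (s≤s (s≤s ())))) _

  DistBy : Set → Vertex → Vertex → ℕ → ℕ → Set
  DistBy A u x near far = (A → Dist u x near) × (¬ A → Dist u x far)

  DistBy-sym : ∀ {A u x near far} → DistBy A u x near far → DistBy A x u near far
  DistBy-sym (d , d′) = (λ a → Dist-sym (d a)) , (λ ¬a → Dist-sym (d′ ¬a))

  incidence-DistBy : ∀ P n → DistBy (P I line n) (inj₁ P) (inj₂ n) 1 3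
  incidence-DistBy P n = dist-incident , dist-nonincident

  class-DistBy : ∀ {P R} → P ≢ R → DistBy (R I classLine P) (inj₁ P) (inj₁ R) 4 2
  class-DistBy P≢R = dist-same-class P≢R , dist-other-class

  direction-DistBy : ∀ {l n} → l ≢ n → DistBy (Parallel (line n) (line l)) (inj₂ l) (inj₂ n) 4 2
  direction-DistBy l≢n = (λ par → dist-parallel l≢n (parallel-sym par))
                       , (λ ¬par → dist-nonparallel (λ par → ¬par (parallel-sym par)))

  DistBy-dist : ∀ {A u x near far} → Dec A → DistBy A u x near far → ∃ (Dist u x)
  DistBy-dist (yes a) (d , _) = _ , d a
  DistBy-dist (no ¬a) (_ , d′) = _ , d′ ¬a

  equal-dist⇒¬distinguishes : ∀ {u v x k} → Dist u x k → Dist v x k → ¬ Distinguishes x u v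
  equal-dist⇒¬distinguishes du dv (_ , inj₁ (du′ , ¬dv)) = ¬dv (subst (Dist _ _) (Dist-functional du du′) dv)
  equal-dist⇒¬distinguishes du dv (_ , inj₂ (dv′ , ¬du)) = ¬du (subst (Dist _ _) (Dist-functional dv dv′) du)

  different-dist⇒distinguishes : ∀ {u v x k k′} → Dist u x k → Dist v x k′ → k ≢ k′ → Distinguishes x u v
  different-dist⇒distinguishes {k = k} du dv k≢k′ = k , inj₁ (du , λ dv′ → k≢k′ (Dist-functional dv′ dv))

  DistBy-¬distinguishes : ∀ {A B u v x near far} → Dec A →
    DistBy A u x near far → DistBy B v x near far → A ⇔ B → ¬ Distinguishes x u v
  DistBy-¬distinguishes (yes a) (du , _) (dv , _) A⇔B = equal-dist⇒¬distinguishes (du a) (dv (Equivalence.to A⇔B a))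
  DistBy-¬distinguishes (no ¬a) (_ , du) (_ , dv) A⇔B =
    equal-dist⇒¬distinguishes (du ¬a) (dv (λ b → ¬a (Equivalence.from A⇔B b)))

  DistBy-distinguishes : ∀ {A B u v x near far} → near ≢ far →
    DistBy A u x near far → DistBy B v x near far → Differ A B → Distinguishes x u v
  DistBy-distinguishes near≢far (du , _) (_ , dv) (inj₁ (a , ¬b)) = different-dist⇒distinguishes (du a) (dv ¬b) near≢far
  DistBy-distinguishes near≢far (_ , du) (dv , _) (inj₂ (¬a , b)) =
    different-dist⇒distinguishes (du ¬a) (dv b) (λ e → near≢far (sym e))

  dist-from-point : ∀ P x → ∃ (Dist (inj₁ P) x)
  dist-from-point P (inj₂ n) = DistBy-dist (incident? P (line n)) (incidence-DistBy P n)
  dist-from-point P (inj₁ R) with P ≟ᴾ R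
  ... | yes refl = 0 , Dist-refl
  ... | no P≢R = DistBy-dist (incident? R (classLine P)) (class-DistBy P≢R)

module Resolution {q : ℕ} (A : AffinePlane q) (l₀ : AffinePlane.Line A)
                  (inP : AffinePlane.Point A → Bool) (inL : Biaffine.BLine A l₀ → Bool) where
  open Biaffine A l₀
  open WithS inP inL
  open Geometry A l₀
  open Equivalence using (to; from)

  inner-point? : ∀ P → Dec (InnerP P)
  inner-point? P = inP P ≟ᴮ true

  inner-line? : ∀ l → Dec (InnerL l)
  inner-line? l = inL l ≟ᴮ true

  inS? : ∀ x → Dec (InS x)
  inS? (inj₁ P) = inner-point? P
  inS? (inj₂ l) = inner-line? l

  inner≢outer : ∀ {P R} → InnerP R → OuterP P → P ≢ R
  inner≢outer iR oP refl with trans (sym iR) oP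
  ... | ()

  inner≢outerᴸ : ∀ {l n} → InnerL n → OuterL l → l ≢ n
  inner≢outerᴸ iN oL refl with trans (sym iN) oL
  ... | ()

  sameClass⇒∈classLine : ∀ {P Q} → SameClass P Q → Q I classLine P
  sameClass⇒∈classLine {P} {Q} (_ , dm , Pm , Qm) = subst (Q I_) (classLine-unique P dm Pm) Qm

  ∈classLine⇒sameClass : ∀ {P Q} → Q I classLine P → SameClass P Q
  ∈classLine⇒sameClass {P} Q∈ = classLine P , classLine-deleted P , ∈-classLine P , Q∈

  sameClass? : ∀ P Q → Dec (SameClass P Q)
  sameClass? P Q = map′ ∈classLine⇒sameClass sameClass⇒∈classLine (incident? Q (classLine P))

  sameClass-refl : ∀ P → SameClass P P
  sameClass-refl P = ∈classLine⇒sameClass (∈-classLine P)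

  sameClass-sym : ∀ {P Q} → SameClass P Q → SameClass Q P
  sameClass-sym (m , dm , Pm , Qm) = m , dm , Qm , Pm

  sameClass-trans : ∀ {P Q R} → SameClass P Q → SameClass Q R → SameClass P R
  sameClass-trans {P} {Q} {R} sPQ sQR =
    ∈classLine⇒sameClass (subst (R I_) (sym (classLine-unique Q (classLine-deleted P) (sameClass⇒∈classLine sPQ)))
                                      (sameClass⇒∈classLine sQR))

  sameClass-DistBy : ∀ {P R} → P ≢ R → DistBy (SameClass P R) (inj₁ P) (inj₁ R) 4 2
  sameClass-DistBy P≢R =
    let (near , far) = class-DistBy P≢R
    in (λ sc → near (sameClass⇒∈classLine sc)) , (λ ¬sc → far (λ R∈ → ¬sc (∈classLine⇒sameClass R∈)))

  PointsAgree : Point → Point → Set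
  PointsAgree P Q = (∀ n → InnerL n → P I line n ⇔ Q I line n)
                  × (∀ R → InnerP R → SameClass P R ⇔ SameClass Q R)

  LinesAgree : BLine → BLine → Set
  LinesAgree l m = (∀ R → InnerP R → R I line l ⇔ R I line m)
                 × (∀ n → InnerL n → SameDirection n l ⇔ SameDirection n m)

  OuterPointsSeparated : Set
  OuterPointsSeparated = ∀ P Q → OuterP P → OuterP Q → PointsAgree P Q → P ≡ Q

  OuterLinesSeparated : Set
  OuterLinesSeparated = ∀ l m → OuterL l → OuterL m → LinesAgree l m → l ≡ m

  Resolved : Vertex → Vertex → Set
  Resolved u v = Σ Vertex λ x → InS x × Distinguishes x u v

  Resolved-sym : ∀ {u v} → Resolved u v → Resolved v u
  Resolved-sym (x , x∈S , k , inj₁ d) = x , x∈S , k , inj₂ d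
  Resolved-sym (x , x∈S , k , inj₂ d) = x , x∈S , k , inj₁ d

  inner-resolved : ∀ {u v} → InS u → u ≢ v → Resolved u v
  inner-resolved {u} u∈S u≢v = u , u∈S , 0 , inj₁ (Dist-refl , λ (w , _) → u≢v (sym (Walk-zero w)))

  agreeing-points-unresolved : ∀ {P Q} → OuterP P → OuterP Q → PointsAgree P Q → ¬ Resolved (inj₁ P) (inj₁ Q)
  agreeing-points-unresolved {P} {Q} _ _ (lines , _) (inj₂ n , iN , dis) =
    DistBy-¬distinguishes (incident? P (line n)) (incidence-DistBy P n) (incidence-DistBy Q n) (lines n iN) dis
  agreeing-points-unresolved {P} {Q} oP oQ (_ , classes) (inj₁ R , iR , dis) =
    DistBy-¬distinguishes (sameClass? P R) (sameClass-DistBy (inner≢outer iR oP)) (sameClass-DistBy (inner≢outer iR oQ))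
                          (classes R iR) dis

  agreeing-lines-unresolved : ∀ {l m} → OuterL l → OuterL m → LinesAgree l m → ¬ Resolved (inj₂ l) (inj₂ m)
  agreeing-lines-unresolved {l} {m} _ _ (points , _) (inj₁ R , iR , dis) =
    DistBy-¬distinguishes (incident? R (line l)) (DistBy-sym (incidence-DistBy R l)) (DistBy-sym (incidence-DistBy R m))
                          (points R iR) dis
  agreeing-lines-unresolved {l} {m} oL oM (_ , directions) (inj₂ n , iN , dis) =
    DistBy-¬distinguishes (parallel? (line n) (line l)) (direction-DistBy (inner≢outerᴸ iN oL))
                          (direction-DistBy (inner≢outerᴸ iN oM)) (directions n iN) dis

  points-resolved-or-agree : ∀ {P Q} → OuterP P → OuterP Q → Resolved (inj₁ P) (inj₁ Q) ⊎ PointsAgree P Q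
  points-resolved-or-agree {P} {Q} oP oQ
    with differing-or-⇔ ∃-bline? inner-line? (λ n → incident? P (line n)) (λ n → incident? Q (line n))
  ... | inj₁ (n , iN , differ) =
    inj₁ (inj₂ n , iN , DistBy-distinguishes (λ ()) (incidence-DistBy P n) (incidence-DistBy Q n) differ)
  ... | inj₂ lines with differing-or-⇔ ∃-point? inner-point? (sameClass? P) (sameClass? Q)
  ... | inj₁ (R , iR , differ) =
    inj₁ (inj₁ R , iR , DistBy-distinguishes (λ ()) (sameClass-DistBy (inner≢outer iR oP))
                                             (sameClass-DistBy (inner≢outer iR oQ)) differ)
  ... | inj₂ classes = inj₂ (lines , classes)

  lines-resolved-or-agree : ∀ {l m} → OuterL l → OuterL m → Resolved (inj₂ l) (inj₂ m) ⊎ LinesAgree l m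
  lines-resolved-or-agree {l} {m} oL oM
    with differing-or-⇔ ∃-point? inner-point? (λ R → incident? R (line l)) (λ R → incident? R (line m))
  ... | inj₁ (R , iR , differ) =
    inj₁ (inj₁ R , iR , DistBy-distinguishes (λ ()) (DistBy-sym (incidence-DistBy R l))
                                             (DistBy-sym (incidence-DistBy R m)) differ)
  ... | inj₂ points
    with differing-or-⇔ ∃-bline? inner-line? (λ n → parallel? (line n) (line l)) (λ n → parallel? (line n) (line m))
  ... | inj₁ (n , iN , differ) =
    inj₁ (inj₂ n , iN , DistBy-distinguishes (λ ()) (direction-DistBy (inner≢outerᴸ iN oL))
                                             (direction-DistBy (inner≢outerᴸ iN oM)) differ)
  ... | inj₂ directions = inj₂ (points , directions)

  resolving⇒separated : Resolving → OuterPointsSeparated × OuterLinesSeparated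
  resolving⇒separated res =
      (λ P Q oP oQ agree → inj₁-injective (unresolved⇒equal _ _ (agreeing-points-unresolved oP oQ agree)))
    , (λ l m oL oM agree → inj₂-injective (unresolved⇒equal _ _ (agreeing-lines-unresolved oL oM agree)))
    where
      unresolved⇒equal : ∀ u v → ¬ Resolved u v → u ≡ v
      unresolved⇒equal u v ¬resolved = decidable-stable (Sum.≡-dec _≟ᴾ_ _≟ᴮᴸ_ u v) (λ u≢v → ¬resolved (res u v u≢v))

  -- With S empty, any two distinct points would agree vacuously.
  points-separated⇒S-nonempty : OuterPointsSeparated → ∃ InS
  points-separated⇒S-nonempty separated with ∃-point? inner-point? | ∃-bline? inner-line?
  ... | yes (P , iP) | _ = inj₁ P , iP
  ... | no _ | yes (l , iL) = inj₂ l , iL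
  ... | no ¬innerP | no ¬innerL =
    let (P , Q , _ , P≢Q , _) = nondeg
        outer = λ R → ¬-not (λ iR → ¬innerP (R , iR))
        agree = (λ n iN → ¬⇒⇔ (λ _ → ¬innerL (n , iN)) (λ _ → ¬innerL (n , iN)))
              , (λ R iR → ¬⇒⇔ (λ _ → ¬innerP (R , iR)) (λ _ → ¬innerP (R , iR)))
    in contradiction (separated P Q (outer P) (outer Q) agree) P≢Q

  point-line-resolved : ∃ InS → ∀ P l → Resolved (inj₁ P) (inj₂ l)
  point-line-resolved (x , x∈S) P l =
    let (k , d) = dist-from-point P x
    in x , x∈S , k , inj₁ (d , λ d′ → ¬point-and-line-walks (proj₁ d) (proj₁ d′))

  separated⇒outer-resolved : OuterPointsSeparated → OuterLinesSeparated →
                             ∀ u v → u ≢ v → ¬ InS u → ¬ InS v → Resolved u v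
  separated⇒outer-resolved sepP _ (inj₁ P) (inj₁ Q) P≢Q oP oQ with points-resolved-or-agree (¬-not oP) (¬-not oQ)
  ... | inj₁ resolved = resolved
  ... | inj₂ agree = contradiction (cong inj₁ (sepP P Q (¬-not oP) (¬-not oQ) agree)) P≢Q
  separated⇒outer-resolved _ sepL (inj₂ l) (inj₂ m) l≢m oL oM with lines-resolved-or-agree (¬-not oL) (¬-not oM)
  ... | inj₁ resolved = resolved
  ... | inj₂ agree = contradiction (cong inj₂ (sepL l m (¬-not oL) (¬-not oM) agree)) l≢m
  separated⇒outer-resolved sepP _ (inj₁ P) (inj₂ l) _ _ _ = point-line-resolved (points-separated⇒S-nonempty sepP) P l
  separated⇒outer-resolved sepP _ (inj₂ l) (inj₁ P) _ _ _ =
    Resolved-sym (point-line-resolved (points-separated⇒S-nonempty sepP) P l)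

  separated⇒resolving : OuterPointsSeparated × OuterLinesSeparated → Resolving
  separated⇒resolving (sepP , sepL) u v u≢v with inS? u | inS? v
  ... | yes u∈S | _ = inner-resolved u∈S u≢v
  ... | no _ | yes v∈S = Resolved-sym (inner-resolved v∈S (≢-sym u≢v))
  ... | no u∉S | no v∉S = separated⇒outer-resolved sepP sepL u v u≢v u∉S v∉S

  resolving⇔separated : Resolving ⇔ (OuterPointsSeparated × OuterLinesSeparated)
  resolving⇔separated = mk⇔ resolving⇒separated separated⇒resolving

  unblocked⇒outer : ∀ {P} → Unblocked P → OuterP P
  unblocked⇒outer {P} ub = ¬-not (λ iP → ub P iP (sameClass-refl P))

  dirUncovered⇒outer : ∀ {l} → DirUncovered l → OuterL l
  dirUncovered⇒outer {l} du = ¬-not (λ iL → du l iL parallel-refl)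

  oneCovered-unique : ∀ {P l} → OneCovered P → InnerL l → P I line l → ∀ n → InnerL n → P I line n → n ≡ l
  oneCovered-unique (_ , _ , _ , unique) iL Pl n iN Pn = trans (unique n iN Pn) (sym (unique _ iL Pl))

  tangent-unique : ∀ {P l} → Tangent l → InnerP P → P I line l → ∀ R → InnerP R → R I line l → R ≡ P
  tangent-unique (_ , _ , _ , unique) iP Pl R iR Rl = trans (unique R iR Rl) (sym (unique _ iP Pl))

  separated⇒B1 : OuterPointsSeparated → B1
  separated⇒B1 separated =
      (λ P Q _ sPQ oP uP oQ uQ →
         separated P Q oP oQ ( (λ n iN → ¬⇒⇔ (uP n iN) (uQ n iN))
                             , (λ R _ → mk⇔ (sameClass-trans (sameClass-sym sPQ)) (sameClass-trans sPQ))))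
    , (λ P Q ubP ubQ oP uP oQ uQ →
         separated P Q oP oQ ((λ n iN → ¬⇒⇔ (uP n iN) (uQ n iN)) , (λ R iR → ¬⇒⇔ (ubP R iR) (ubQ R iR))))

  separated⇒B2 : OuterPointsSeparated → B2
  separated⇒B2 separated l iL P Q Pl Ql cP ubP cQ ubQ =
    separated P Q (unblocked⇒outer ubP) (unblocked⇒outer ubQ)
              (lines , (λ R iR → ¬⇒⇔ (ubP R iR) (ubQ R iR)))
    where
      lines : ∀ n → InnerL n → P I line n ⇔ Q I line n
      lines n iN = mk⇔ (λ Pn → subst (λ k → Q I line k) (sym (oneCovered-unique cP iL Pl n iN Pn)) Ql)
                       (λ Qn → subst (λ k → P I line k) (sym (oneCovered-unique cQ iL Ql n iN Qn)) Pl)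

  separated⇒B1′ : OuterLinesSeparated → B1′
  separated⇒B1′ separated =
      (λ l m _ lm oL sL oM sM →
         separated l m oL oM ( (λ R iR → ¬⇒⇔ (sL R iR) (sM R iR))
                             , (λ n _ → mk⇔ (λ nl → parallel-trans {line n} nl lm)
                                            (λ nm → parallel-trans {line n} nm (parallel-sym lm)))))
    , (λ l m uL uM oL sL oM sM →
         separated l m oL oM ((λ R iR → ¬⇒⇔ (sL R iR) (sM R iR)) , (λ n iN → ¬⇒⇔ (uL n iN) (uM n iN))))

  separated⇒B2′ : OuterLinesSeparated → B2′
  separated⇒B2′ separated P iP l m Pl Pm tL uL tM uM =
    separated l m (dirUncovered⇒outer uL) (dirUncovered⇒outer uM)
              (points , (λ n iN → ¬⇒⇔ (uL n iN) (uM n iN)))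
    where
      points : ∀ R → InnerP R → R I line l ⇔ R I line m
      points R iR = mk⇔ (λ Rl → subst (_I line m) (sym (tangent-unique {l = l} tL iP Pl R iR Rl)) Pm)
                        (λ Rm → subst (_I line l) (sym (tangent-unique {l = m} tM iP Pm R iR Rm)) Pl)

  agreeing-same-class-uncovered : ∀ {P Q} → P ≢ Q → SameClass P Q →
    (∀ n → InnerL n → P I line n ⇔ Q I line n) → Uncovered P × Uncovered Q
  agreeing-same-class-uncovered P≢Q sPQ lines =
      (λ n iN Pn → same-class-no-common-bline n P≢Q Q∈ Pn (to (lines n iN) Pn))
    , (λ n iN Qn → same-class-no-common-bline n P≢Q Q∈ (from (lines n iN) Qn) Qn)
    where Q∈ = sameClass⇒∈classLine sPQ

  agreeing-other-classes-unblocked : ∀ {P Q} → ¬ SameClass P Q →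
    (∀ R → InnerP R → SameClass P R ⇔ SameClass Q R) → Unblocked P × Unblocked Q
  agreeing-other-classes-unblocked ¬sPQ classes =
      (λ R iR sPR → ¬sPQ (sameClass-trans sPR (sameClass-sym (to (classes R iR) sPR))))
    , (λ R iR sQR → ¬sPQ (sameClass-trans (from (classes R iR) sQR) (sameClass-sym sQR)))

  agreeing-common-line-oneCovered : ∀ {P Q n} → P ≢ Q → (∀ n → InnerL n → P I line n ⇔ Q I line n) →
    InnerL n → P I line n → Q I line n → OneCovered P × OneCovered Q
  agreeing-common-line-oneCovered {n = n} P≢Q lines iN Pn Qn =
      (n , iN , Pn , λ n′ iN′ Pn′ → bline-injective (join-unique P≢Q Pn′ (to (lines n′ iN′) Pn′) Pn Qn))
    , (n , iN , Qn , λ n′ iN′ Qn′ → bline-injective (join-unique P≢Q (from (lines n′ iN′) Qn′) Qn′ Pn Qn))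

  B1⇒same-class-separated : B1 → ∀ P Q → SameClass P Q → OuterP P → OuterP Q → PointsAgree P Q → P ≡ Q
  B1⇒same-class-separated (blocked-case , unblocked-case) P Q sPQ oP oQ (lines , _) with P ≟ᴾ Q
  ... | yes P≡Q = P≡Q
  ... | no P≢Q with agreeing-same-class-uncovered P≢Q sPQ lines
                  | ∃-point? (λ R → inner-point? R ×-dec sameClass? P R)
  ... | uP , uQ | yes blocked = blocked-case P Q blocked sPQ oP uP oQ uQ
  ... | uP , uQ | no ¬blocked =
    unblocked-case P Q (λ R iR sPR → ¬blocked (R , iR , sPR)) (λ R iR sQR → ¬blocked (R , iR , sameClass-trans sPQ sQR))
                   oP uP oQ uQ

  B1×B2⇒other-classes-separated : B1 → B2 → ∀ P Q → ¬ SameClass P Q → OuterP P → OuterP Q → PointsAgree P Q → P ≡ Q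
  B1×B2⇒other-classes-separated (_ , unblocked-case) b2 P Q ¬sPQ oP oQ (lines , classes) with P ≟ᴾ Q
  ... | yes P≡Q = P≡Q
  ... | no P≢Q with agreeing-other-classes-unblocked ¬sPQ classes
                  | ∃-bline? (λ n → inner-line? n ×-dec incident? P (line n))
  ... | ubP , ubQ | yes (n , iN , Pn) =
    let Qn = to (lines n iN) Pn
        (cP , cQ) = agreeing-common-line-oneCovered P≢Q lines iN Pn Qn
    in b2 n iN P Q Pn Qn cP ubP cQ ubQ
  ... | ubP , ubQ | no ¬covered =
    unblocked-case P Q ubP ubQ oP (λ n iN Pn → ¬covered (n , iN , Pn))
                   oQ (λ n iN Qn → ¬covered (n , iN , from (lines n iN) Qn))

  B1×B2⇒separated : B1 × B2 → OuterPointsSeparated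
  B1×B2⇒separated (b1 , b2) P Q with sameClass? P Q
  ... | yes sPQ = B1⇒same-class-separated b1 P Q sPQ
  ... | no ¬sPQ = B1×B2⇒other-classes-separated b1 b2 P Q ¬sPQ

  points-separated⇔B1×B2 : OuterPointsSeparated ⇔ (B1 × B2)
  points-separated⇔B1×B2 = mk⇔ (λ sep → separated⇒B1 sep , separated⇒B2 sep) B1×B2⇒separated

  agreeing-parallel-skew : ∀ {l m} → l ≢ m → SameDirection l m →
    (∀ R → InnerP R → R I line l ⇔ R I line m) → Skew l × Skew m
  agreeing-parallel-skew l≢m lm points =
      (λ R iR Rl → distinct-parallel⇒disjoint l≢m lm R Rl (to (points R iR) Rl))
    , (λ R iR Rm → distinct-parallel⇒disjoint l≢m lm R (from (points R iR) Rm) Rm)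

  agreeing-nonparallel-dirUncovered : ∀ {l m} → ¬ SameDirection l m →
    (∀ n → InnerL n → SameDirection n l ⇔ SameDirection n m) → DirUncovered l × DirUncovered m
  agreeing-nonparallel-dirUncovered ¬lm directions =
      (λ n iN nl → ¬lm (parallel-trans (parallel-sym nl) (to (directions n iN) nl)))
    , (λ n iN nm → ¬lm (parallel-trans (parallel-sym (from (directions n iN) nm)) nm))

  agreeing-common-point-tangent : ∀ {l m R} → l ≢ m → (∀ R → InnerP R → R I line l ⇔ R I line m) →
    InnerP R → R I line l → R I line m → Tangent l × Tangent m
  agreeing-common-point-tangent {l} {m} {R} l≢m points iR Rl Rm =
      (R , iR , Rl , λ R′ iR′ R′l → unique R′ R′l (to (points R′ iR′) R′l))
    , (R , iR , Rm , λ R′ iR′ R′m → unique R′ (from (points R′ iR′) R′m) R′m)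
    where
      unique : ∀ R′ → R′ I line l → R′ I line m → R′ ≡ R
      unique R′ R′l R′m =
        decidable-stable (R′ ≟ᴾ R) (λ R′≢R → l≢m (bline-injective (join-unique R′≢R R′l Rl R′m Rm)))

  B1′⇒parallel-separated : B1′ → ∀ l m → SameDirection l m → OuterL l → OuterL m → LinesAgree l m → l ≡ m
  B1′⇒parallel-separated (covered-case , uncovered-case) l m lm oL oM (points , _) with l ≟ᴮᴸ m
  ... | yes l≡m = l≡m
  ... | no l≢m with agreeing-parallel-skew l≢m lm points
                  | ∃-bline? (λ n → inner-line? n ×-dec parallel? (line n) (line l))
  ... | sL , sM | yes covered = covered-case l m covered lm oL sL oM sM
  ... | sL , sM | no ¬covered =
    uncovered-case l m (λ n iN nl → ¬covered (n , iN , nl))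
                   (λ n iN nm → ¬covered (n , iN , parallel-trans nm (parallel-sym lm))) oL sL oM sM

  B1′×B2′⇒nonparallel-separated : B1′ → B2′ → ∀ l m → ¬ SameDirection l m → OuterL l → OuterL m →
                                  LinesAgree l m → l ≡ m
  B1′×B2′⇒nonparallel-separated (_ , uncovered-case) b2′ l m ¬lm oL oM (points , directions) with l ≟ᴮᴸ m
  ... | yes l≡m = l≡m
  ... | no l≢m with agreeing-nonparallel-dirUncovered {l} {m} ¬lm directions
                  | ∃-point? (λ R → inner-point? R ×-dec incident? R (line l))
  ... | uL , uM | yes (R , iR , Rl) =
    let Rm = to (points R iR) Rl
        (tL , tM) = agreeing-common-point-tangent l≢m points iR Rl Rm
    in b2′ R iR l m Rl Rm tL uL tM uM
  ... | uL , uM | no ¬met =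
    uncovered-case l m uL uM oL (λ R iR Rl → ¬met (R , iR , Rl))
                   oM (λ R iR Rm → ¬met (R , iR , from (points R iR) Rm))

  B1′×B2′⇒separated : B1′ × B2′ → OuterLinesSeparated
  B1′×B2′⇒separated (b1′ , b2′) l m with parallel? (line l) (line m)
  ... | yes lm = B1′⇒parallel-separated b1′ l m lm
  ... | no ¬lm = B1′×B2′⇒nonparallel-separated b1′ b2′ l m ¬lm

  lines-separated⇔B1′×B2′ : OuterLinesSeparated ⇔ (B1′ × B2′)
  lines-separated⇔B1′×B2′ = mk⇔ (λ sep → separated⇒B1′ sep , separated⇒B2′ sep) B1′×B2′⇒separated

mainTheorem12 : ∀ {q : ℕ} (A : AffinePlane q) (l₀ : AffinePlane.Line A)
  (inP : AffinePlane.Point A → Bool) (inL : Biaffine.BLine A l₀ → Bool) →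
  Biaffine.WithS.Resolving A l₀ inP inL ⇔
    (Biaffine.WithS.B1 A l₀ inP inL × Biaffine.WithS.B2 A l₀ inP inL ×
     Biaffine.WithS.B1′ A l₀ inP inL × Biaffine.WithS.B2′ A l₀ inP inL)
mainTheorem12 A l₀ inP inL = mk⇔
  (λ resolving →
    let (sepP , sepL) = to resolving⇔separated resolving
        (b1 , b2) = to points-separated⇔B1×B2 sepP
        (b1′ , b2′) = to lines-separated⇔B1′×B2′ sepL
    in b1 , b2 , b1′ , b2′)
  (λ (b1 , b2 , b1′ , b2′) →
    from resolving⇔separated (from points-separated⇔B1×B2 (b1 , b2) , from lines-separated⇔B1′×B2′ (b1′ , b2′)))
  where
    open Resolution A l₀ inP inL
    open Equivalence
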